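{- Let $P=a_1a_2\dots a_\ell$ be a $\Sigma$-pattern with $a_1\in\Sigma$ such that $\mathrm{T}(P)$ is completely additive and not the constant zero sequence. Then $a_1=0$ and $a_\ell=\rho_d$ for some $d\in\Sigma$ (i.e. $a_\ell$ is a gap acting as $x\mapsto x+d$ on every letter occurring in $\mathrm{T}(P)$).
   Context: $\Sigma$ is a finite cyclic group; gaps are elements of $\mathrm{S}_\Sigma$, the bijections of $\Sigma$; $\rho_d$ is $x\mapsto x+d$, $?$ the identity. A $\Sigma$-pattern is a nonempty word over $\Sigma\cup\mathrm{S}_\Sigma$. For words $x,y$: $(a\,x)\langle y\rangle=a\,x\langle y\rangle$, $(f\,x)\langle b\,y\rangle=f(b)\,x\langle y\rangle$, $(f\,x)\langle g\,y\rangle=(f\circ g)\,x\langle y\rangle$. For $P$ with first symbol in $\Sigma$: $T_0=?^\omega$, $T_{i+1}=P^\omega\langle T_i\rangle$, $\mathrm{T}(P)=\lim_iT_i$, indexed by positive integers. Completely additive: $\sigma(1)=0$, $\sigma(nm)=\sigma(n)+\sigma(m)$. Convention: if $\mathrm{T}(P)$ is not surjective, a gap in $P$ is identified with every bijection agreeing with it on the letters occurring in $\mathrm{T}(P)$. -}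

module Defs where

open import Data.Nat using (ℕ; zero; suc; _+_; _*_; _∸_; _≤_)
open import Data.Nat.DivMod using (_mod_)
open import Data.Fin using (Fin; toℕ; zero)
open import Data.Fin.Permutation using (Permutation; _⟨$⟩ʳ_; _∘ₚ_) renaming (id to idₚ)
open import Data.Vec using (Vec; lookup)
open import Data.Product using (∃; _×_)
open import Relation.Binary.PropositionalEquality using (_≡_)

-- The alphabet Σ is the cyclic group ℤ/(suc k)ℤ, carried by Fin (suc k).
-- Addition in Σ.
_⊕_ : ∀ {k} → Fin (suc k) → Fin (suc k) → Fin (suc k)
_⊕_ {k} a b = (toℕ a + toℕ b) mod (suc k)

ρ : ∀ {k} → Fin (suc k) → Fin (suc k) → Fin (suc k)
ρ d x = x ⊕ d

data Sym (n : ℕ) : Set where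
  letter : Fin n → Sym n
  gap    : Permutation n n → Sym n

-- Infinite words (indexed from 0; position m corresponds to index m+1).
Word : ℕ → Set
Word n = ℕ → Sym n

gapInd : ∀ {n} → Sym n → ℕ
gapInd (letter _) = 0
gapInd (gap _)    = 1

gapsBefore : ∀ {n} → Word n → ℕ → ℕ
gapsBefore w zero    = 0
gapsBefore w (suc m) = gapsBefore w m + gapInd (w m)

-- composition of gaps: compose f g = f ∘ g  (note π₁ ∘ₚ π₂ applies π₁ first)
compose : ∀ {n} → Permutation n n → Permutation n n → Permutation n n
compose f g = g ∘ₚ f

fillSym : ∀ {n} → Permutation n n → Sym n → Sym n
fillSym f (letter b) = letter (f ⟨$⟩ʳ b)
fillSym f (gap g)    = gap (compose f g)

-- x⟨y⟩ for infinite words x, y: the i-th gap of x is filled with the i-th symbol of y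
fill : ∀ {n} → Word n → Word n → Word n
fill x y m with x m
... | letter a = letter a
... | gap f    = fillSym f (y (gapsBefore x m))

Pattern : ℕ → ℕ → Set
Pattern n l = Vec (Sym n) (suc l)

periodic : ∀ {n l} → Pattern n l → Word n
periodic {n} {l} P m = lookup P (m mod (suc l))

-- T_0 = ?^ω, T_{i+1} = P^ω⟨T_i⟩
Tseq : ∀ {n l} → Pattern n l → ℕ → Word n
Tseq P zero    = λ _ → gap idₚ
Tseq P (suc i) = fill (periodic P) (Tseq P i)

-- t is the limit T(P) = lim_i T_i (pointwise eventual stabilisation, to letters of Σ)
IsLimitT : ∀ {n l} → Pattern n l → (ℕ → Fin n) → Set
IsLimitT P t = ∀ m → ∃ λ N → ∀ i → N ≤ i → Tseq P i m ≡ letter (t m)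

-- View a 0-indexed sequence as indexed by positive integers: σ(j) = t(j-1), j ≥ 1
atPos : ∀ {n} → (ℕ → Fin n) → ℕ → Fin n
atPos t j = t (j ∸ 1)

CompletelyAdditive : ∀ {k} → (ℕ → Fin (suc k)) → Set
CompletelyAdditive t =
  (atPos t 1 ≡ zero) × (∀ a b → 1 ≤ a → 1 ≤ b → atPos t (a * b) ≡ atPos t a ⊕ atPos t b)

module Submission where

-- Write σ(j) = t(j-1) for the limit word read at positive
-- integers j, and ℓ = suc l for the length of P.  The limit is a fixed point of
-- the construction, T(P) = P^ω⟨T(P)⟩: a letter b of P^ω at position m forces
-- t(m) = b, and a gap f there forces t(m) = f(t(g)) where g counts the gaps of
-- P^ω before m.  Evaluated at the ends of the blocks of P^ω this says
--   σ(ℓ·q) = c             if last P is the letter c,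
--   σ(ℓ·q) = f(σ(c·q))     if last P is the gap f and c is the number of gaps of P.
-- A completely additive σ with values in Σ = ℤ/(k+1) kills (k+1)-st powers,
-- so σ(x^(k+1)·q) = σ(q).  With x = ℓ the letter case makes σ constant, hence
-- zero (σ(1) = 0), contradicting non-triviality.  With x = c the gap case gives
-- f(σ(q)) = σ(ℓ·c^k·q) = σ(q) + σ(ℓ·c^k), so f acts as ρ_d with d = σ(ℓ·c^k).
-- Finally σ(1) = t(0) = a₁ by the first symbol of P, so a₁ = 0.

open import Defs
open import Data.Nat using (ℕ; suc; zero; _+_; _*_; _∸_; _≤_; _^_; _%_; s≤s; z≤n; >-nonZero)
open import Data.Nat.Properties
open import Data.Nat.DivMod using (_mod_; [m+n]%n≡m%n; m*n%n≡0; %-distribˡ-+; m<n⇒m%n≡m)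
open import Data.Nat.Tactic.RingSolver using (solve-∀)
open import Data.Fin using (Fin; zero; toℕ; fromℕ)
open import Data.Fin.Properties using (toℕ-injective; toℕ-fromℕ<; toℕ-fromℕ; toℕ<n)
open import Data.Fin.Permutation using (_⟨$⟩ʳ_)
open import Data.Vec using (Vec; head; last; lookup; _∷_; [])
open import Data.Product using (∃; _×_; _,_; proj₁; proj₂)
open import Data.Empty using (⊥-elim)
open import Relation.Binary.PropositionalEquality
open ≡-Reasoning

toℕ-mod : ∀ m k → toℕ (m mod suc k) ≡ m % suc k
toℕ-mod m k = toℕ-fromℕ< _

zero-⊕ : ∀ {k} (x : Fin (suc k)) → zero ⊕ x ≡ x
zero-⊕ {k} x = toℕ-injective (trans (toℕ-mod (toℕ x) k) (m<n⇒m%n≡m (toℕ<n x)))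

pow-positive : ∀ {x} → 1 ≤ x → ∀ e → 1 ≤ x ^ e
pow-positive {x} x≥1 e = m^n>0 x {{>-nonZero x≥1}} e

-- Index arithmetic: the last position of the (q+1)-st block of length suc a.
pred-product : ∀ a q → suc a * suc q ∸ 1 ≡ q * suc a + a
pred-product a q = lemma a q
  where
  lemma : ∀ a q → q + a * suc q ≡ q * suc a + a
  lemma = solve-∀

lookup-fromℕ : ∀ {A : Set} {n} (xs : Vec A (suc n)) → lookup xs (fromℕ n) ≡ last xs
lookup-fromℕ (x ∷ [])     = refl
lookup-fromℕ (x ∷ y ∷ ys) = lookup-fromℕ (y ∷ ys)

periodic-lookup : ∀ {n l} (P : Pattern n l) (i : Fin (suc l)) → periodic P (toℕ i) ≡ lookup P i
periodic-lookup {l = l} P i =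
  cong (lookup P) (toℕ-injective (trans (toℕ-mod (toℕ i) l) (m<n⇒m%n≡m (toℕ<n i))))

periodic-head : ∀ {n l} (P : Pattern n l) → periodic P 0 ≡ head P
periodic-head (x ∷ xs) = periodic-lookup (x ∷ xs) zero

periodic-last : ∀ {n l} (P : Pattern n l) → periodic P l ≡ last P
periodic-last {l = l} P = begin
  periodic P l                  ≡⟨ cong (periodic P) (sym (toℕ-fromℕ l)) ⟩
  periodic P (toℕ (fromℕ l))    ≡⟨ periodic-lookup P (fromℕ l) ⟩
  lookup P (fromℕ l)            ≡⟨ lookup-fromℕ P ⟩
  last P                        ∎

periodic-period : ∀ {n l} (P : Pattern n l) j → periodic P (suc l + j) ≡ periodic P j
periodic-period {l = l} P j = cong (lookup P) (toℕ-injective (begin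
  toℕ ((suc l + j) mod suc l)  ≡⟨ toℕ-mod (suc l + j) l ⟩
  (suc l + j) % suc l          ≡⟨ cong (_% suc l) (+-comm (suc l) j) ⟩
  (j + suc l) % suc l          ≡⟨ [m+n]%n≡m%n j (suc l) ⟩
  j % suc l                    ≡⟨ sym (toℕ-mod j l) ⟩
  toℕ (j mod suc l)            ∎))

periodic-shift : ∀ {n l} (P : Pattern n l) q j → periodic P (q * suc l + j) ≡ periodic P j
periodic-shift P zero    j = refl
periodic-shift {l = l} P (suc q) j =
  trans (cong (periodic P) (+-assoc (suc l) (q * suc l) j))
        (trans (periodic-period P (q * suc l + j)) (periodic-shift P q j))

gapsBefore-period : ∀ {n l} (P : Pattern n l) j →
  gapsBefore (periodic P) (suc l + j) ≡ gapsBefore (periodic P) (suc l) + gapsBefore (periodic P) j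
gapsBefore-period {l = l} P zero = trans (cong (gapsBefore (periodic P)) (+-identityʳ (suc l)))
                                         (sym (+-identityʳ _))
gapsBefore-period {l = l} P (suc j) = begin
  gapsBefore w (suc l + suc j)                   ≡⟨ cong (gapsBefore w) (+-suc (suc l) j) ⟩
  gapsBefore w (suc l + j) + gapInd (w (suc l + j))
    ≡⟨ cong₂ _+_ (gapsBefore-period P j) (cong gapInd (periodic-period P j)) ⟩
  (c + gapsBefore w j) + gapInd (w j)            ≡⟨ +-assoc c _ _ ⟩
  c + (gapsBefore w j + gapInd (w j))            ∎
  where
  w = periodic P
  c = gapsBefore w (suc l)

gapsBefore-shift : ∀ {n l} (P : Pattern n l) q j →
  gapsBefore (periodic P) (q * suc l + j) ≡ q * gapsBefore (periodic P) (suc l) + gapsBefore (periodic P) j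
gapsBefore-shift P zero j = refl
gapsBefore-shift {l = l} P (suc q) j = begin
  gapsBefore w ((suc l + q * suc l) + j)  ≡⟨ cong (gapsBefore w) (+-assoc (suc l) (q * suc l) j) ⟩
  gapsBefore w (suc l + (q * suc l + j))  ≡⟨ gapsBefore-period P _ ⟩
  c + gapsBefore w (q * suc l + j)        ≡⟨ cong (c +_) (gapsBefore-shift P q j) ⟩
  c + (q * c + gapsBefore w j)            ≡⟨ sym (+-assoc c _ _) ⟩
  (c + q * c) + gapsBefore w j            ∎
  where
  w = periodic P
  c = gapsBefore w (suc l)

module FixedPoint {n l} (P : Pattern n l) (t : ℕ → Fin n) (lim : IsLimitT P t) where

  w : Word n
  w = periodic P

  letter-injective : ∀ {a b : Fin n} → letter a ≡ letter b → a ≡ b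
  letter-injective refl = refl

  step-letter : ∀ i m b → w m ≡ letter b → Tseq P (suc i) m ≡ letter b
  step-letter i m b eq rewrite eq = refl

  step-gap : ∀ i m f → w m ≡ gap f → Tseq P (suc i) m ≡ fillSym f (Tseq P i (gapsBefore w m))
  step-gap i m f eq rewrite eq = refl

  at-letter : ∀ m b → w m ≡ letter b → t m ≡ b
  at-letter m b eq with lim m
  ... | N , stable = letter-injective (trans (sym (stable (suc N) (n≤1+n N))) (step-letter N m b eq))

  at-gap : ∀ m f → w m ≡ gap f → t m ≡ f ⟨$⟩ʳ t (gapsBefore w m)
  at-gap m f eq with lim m | lim (gapsBefore w m)
  ... | N₁ , stable₁ | N₂ , stable₂ = letter-injective (begin
    letter (t m)                            ≡⟨ sym (stable₁ (suc i) (m≤n⇒m≤1+n (m≤m+n N₁ N₂))) ⟩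
    Tseq P (suc i) m                        ≡⟨ step-gap i m f eq ⟩
    fillSym f (Tseq P i (gapsBefore w m))   ≡⟨ cong (fillSym f) (stable₂ i (m≤n+m N₂ N₁)) ⟩
    letter (f ⟨$⟩ʳ t (gapsBefore w m))      ∎)
    where
    i = N₁ + N₂

module Additive {k : ℕ} (t : ℕ → Fin (suc k)) (additive : CompletelyAdditive t) where

  σ : ℕ → Fin (suc k)
  σ = atPos t

  σ-mult : ∀ a b → 1 ≤ a → 1 ≤ b → σ (a * b) ≡ σ a ⊕ σ b
  σ-mult = proj₂ additive

  σ-pow : ∀ x → 1 ≤ x → ∀ e → toℕ (σ (x ^ e)) ≡ (e * toℕ (σ x)) % suc k
  σ-pow x x≥1 zero    = cong toℕ (proj₁ additive)
  σ-pow x x≥1 (suc e) = begin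
    toℕ (σ (x * x ^ e))                     ≡⟨ cong toℕ (σ-mult x (x ^ e) x≥1 (pow-positive x≥1 e)) ⟩
    toℕ (σ x ⊕ σ (x ^ e))                   ≡⟨ toℕ-mod (a + toℕ (σ (x ^ e))) k ⟩
    (a + toℕ (σ (x ^ e))) % suc k           ≡⟨ cong (λ z → (z + toℕ (σ (x ^ e))) % suc k)
                                                    (sym (m<n⇒m%n≡m (toℕ<n (σ x)))) ⟩
    (a % suc k + toℕ (σ (x ^ e))) % suc k   ≡⟨ cong (λ z → (a % suc k + z) % suc k) (σ-pow x x≥1 e) ⟩
    (a % suc k + (e * a) % suc k) % suc k   ≡⟨ sym (%-distribˡ-+ a (e * a) (suc k)) ⟩
    (a + e * a) % suc k                     ∎
    where
    a = toℕ (σ x)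

  -- Σ has exponent suc k, so σ vanishes on (suc k)-th powers …
  σ-pow-vanishes : ∀ x → 1 ≤ x → σ (x ^ suc k) ≡ zero
  σ-pow-vanishes x x≥1 = toℕ-injective (trans (σ-pow x x≥1 (suc k))
    (trans (cong (_% suc k) (*-comm (suc k) (toℕ (σ x)))) (m*n%n≡0 (toℕ (σ x)) (suc k))))

  σ-absorb : ∀ x q → 1 ≤ x → 1 ≤ q → σ (x ^ suc k * q) ≡ σ q
  σ-absorb x q x≥1 q≥1 = begin
    σ (x ^ suc k * q)        ≡⟨ σ-mult (x ^ suc k) q (pow-positive x≥1 (suc k)) q≥1 ⟩
    σ (x ^ suc k) ⊕ σ q      ≡⟨ cong (_⊕ σ q) (σ-pow-vanishes x x≥1) ⟩
    zero ⊕ σ q               ≡⟨ zero-⊕ (σ q) ⟩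
    σ q                      ∎

module LastSymbol {k l : ℕ} (P : Pattern (suc k) l) (t : ℕ → Fin (suc k))
                  (lim : IsLimitT P t) (additive : CompletelyAdditive t) where

  open FixedPoint P t lim
  open Additive t additive

  ℓ : ℕ
  ℓ = suc l

  -- Position ℓ·q (1-indexed) is the end of the q-th block, where P^ω reads last P.
  periodic-blockEnd : ∀ q → periodic P (ℓ * suc q ∸ 1) ≡ last P
  periodic-blockEnd q = begin
    periodic P (ℓ * suc q ∸ 1)   ≡⟨ cong (periodic P) (pred-product l q) ⟩
    periodic P (q * ℓ + l)       ≡⟨ periodic-shift P q l ⟩
    periodic P l                 ≡⟨ periodic-last P ⟩
    last P                       ∎

  -- If P ends in a letter c, then σ(ℓ·q) = c, so σ is the constant c and hence zero.
  last-letter-trivial : ∀ {c} → last P ≡ letter c → ∀ m → t m ≡ zero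
  last-letter-trivial {c} last≡c m = begin
    σ (suc m)     ≡⟨ σ-constant (suc m) (s≤s z≤n) ⟩
    c             ≡⟨ sym (σ-constant 1 (s≤s z≤n)) ⟩
    σ 1           ≡⟨ proj₁ additive ⟩
    zero          ∎
    where
    σ-blockEnd : ∀ q → 1 ≤ q → σ (ℓ * q) ≡ c
    σ-blockEnd (suc q) _ = at-letter _ c (trans (periodic-blockEnd q) last≡c)

    σ-constant : ∀ q → 1 ≤ q → σ q ≡ c
    σ-constant q q≥1 = begin
      σ q                    ≡⟨ sym (σ-absorb ℓ q (s≤s z≤n) q≥1) ⟩
      σ (ℓ ^ suc k * q)      ≡⟨ cong σ (*-assoc ℓ (ℓ ^ k) q) ⟩
      σ (ℓ * (ℓ ^ k * q))    ≡⟨ σ-blockEnd (ℓ ^ k * q) (*-mono-≤ (pow-positive (s≤s z≤n) k) q≥1) ⟩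
      c                      ∎

  gaps-per-block : ∀ {f} → last P ≡ gap f → gapsBefore w ℓ ≡ suc (gapsBefore w l)
  gaps-per-block last≡f =
    trans (cong (λ s → gapsBefore w l + gapInd s) (trans (periodic-last P) last≡f))
          (+-comm (gapsBefore w l) 1)

  σ-blockEnd-gap : ∀ {f} → last P ≡ gap f →
    ∀ q → 1 ≤ q → σ (ℓ * q) ≡ f ⟨$⟩ʳ σ (gapsBefore w ℓ * q)
  σ-blockEnd-gap {f} last≡f (suc q) _ = begin
    t (ℓ * suc q ∸ 1)                    ≡⟨ cong t (pred-product l q) ⟩
    t (q * ℓ + l)                        ≡⟨ at-gap _ f end≡f ⟩
    f ⟨$⟩ʳ t (gapsBefore w (q * ℓ + l))  ≡⟨ cong (λ g → f ⟨$⟩ʳ t g) (gapsBefore-shift P q l) ⟩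
    f ⟨$⟩ʳ t (q * c + e)                 ≡⟨ cong (λ c′ → f ⟨$⟩ʳ t (q * c′ + e)) c≡ ⟩
    f ⟨$⟩ʳ t (q * suc e + e)             ≡⟨ cong (λ g → f ⟨$⟩ʳ t g) (sym (pred-product e q)) ⟩
    f ⟨$⟩ʳ σ (suc e * suc q)             ≡⟨ cong (λ c′ → f ⟨$⟩ʳ σ (c′ * suc q)) (sym c≡) ⟩
    f ⟨$⟩ʳ σ (c * suc q)                 ∎
    where
    c = gapsBefore w ℓ
    e = gapsBefore w l
    c≡ = gaps-per-block last≡f
    end≡f : periodic P (q * ℓ + l) ≡ gap f
    end≡f = trans (cong (periodic P) (sym (pred-product l q))) (trans (periodic-blockEnd q) last≡f)

  last-gap-translation : ∀ {f} → last P ≡ gap f →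
    ∀ m → f ⟨$⟩ʳ t m ≡ ρ (σ (ℓ * gapsBefore w ℓ ^ k)) (t m)
  last-gap-translation {f} last≡f m = begin
    f ⟨$⟩ʳ σ q                      ≡⟨ cong (f ⟨$⟩ʳ_) (sym (σ-absorb c q c≥1 q≥1)) ⟩
    f ⟨$⟩ʳ σ (c ^ suc k * q)        ≡⟨ cong (λ j → f ⟨$⟩ʳ σ j) (*-assoc c (c ^ k) q) ⟩
    f ⟨$⟩ʳ σ (c * (c ^ k * q))      ≡⟨ sym (σ-blockEnd-gap last≡f (c ^ k * q) cᵏq≥1) ⟩
    σ (ℓ * (c ^ k * q))             ≡⟨ cong σ (reassoc ℓ (c ^ k) q) ⟩
    σ (q * (ℓ * c ^ k))             ≡⟨ σ-mult q (ℓ * c ^ k) q≥1 (*-mono-≤ {1} {ℓ} (s≤s z≤n) cᵏ≥1) ⟩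
    σ q ⊕ σ (ℓ * c ^ k)             ∎
    where
    q = suc m
    c = gapsBefore w ℓ
    q≥1 : 1 ≤ q
    q≥1 = s≤s z≤n
    c≥1 : 1 ≤ c
    c≥1 = subst (1 ≤_) (sym (gaps-per-block last≡f)) (s≤s z≤n)
    cᵏ≥1 : 1 ≤ c ^ k
    cᵏ≥1 = pow-positive c≥1 k
    cᵏq≥1 : 1 ≤ c ^ k * q
    cᵏq≥1 = *-mono-≤ cᵏ≥1 q≥1
    reassoc : ∀ a b q → a * (b * q) ≡ q * (a * b)
    reassoc = solve-∀

mainTheorem11 : (k l : ℕ) (P : Pattern (suc k) l) (t : ℕ → Fin (suc k)) →
    (∃ λ a → head P ≡ letter a) →
    IsLimitT P t →
    CompletelyAdditive t →
    (∃ λ m → t m ≢ zero) →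
    (head P ≡ letter zero) ×
    (∃ λ f → ∃ λ d → (last P ≡ gap f) ×
    (∀ m → f ⟨$⟩ʳ t m ≡ ρ d (t m)))
mainTheorem11 k l P t (a , head≡a) lim additive (m₀ , t≢0) = head≡0 , last-is-translation
  where
  open FixedPoint P t lim using (at-letter)
  open LastSymbol P t lim additive

  head≡0 : head P ≡ letter zero
  head≡0 = trans head≡a (cong letter (begin
    a     ≡⟨ sym (at-letter 0 a (trans (periodic-head P) head≡a)) ⟩
    t 0   ≡⟨ proj₁ additive ⟩
    zero  ∎))

  -- A final letter would force T(P) = 0, so P ends in a gap, which is a translation.
  last-is-translation : ∃ λ f → ∃ λ d → (last P ≡ gap f) × (∀ m → f ⟨$⟩ʳ t m ≡ ρ d (t m))
  last-is-translation with last P in last≡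
  ... | letter c = ⊥-elim (t≢0 (last-letter-trivial last≡ m₀))
  ... | gap f    = f , _ , refl , last-gap-translation last≡
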